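{- For $n\ge 4$, $D_f(Q_n;Q_1)\ge n+1$ and $D^s_f(Q_n;Q_1)\ge n+1$.
   Context: The $n$-dimensional hypercube $Q_n$ is the graph whose vertices are the binary strings of length $n$, two vertices being adjacent iff they differ in exactly one position; $Q_1\cong K_2$. The diameter of a graph is the maximum graph distance between two of its vertices. For a graph $G$ and a graph $W$, a $W$-structure in $G$ is a subgraph of $G$ isomorphic to $W$, and a $W$-substructure is a subgraph of $G$ isomorphic to a connected subgraph of $W$. Removing a family of subgraphs means deleting all their vertices. $\kappa(G;W)$ (resp. $\kappa^s(G;W)$) is the minimum number $t$ such that there exist $t$ pairwise vertex-disjoint $W$-structures (resp. $W$-substructures) whose removal disconnects $G$. $D_f(G;W)$ (resp. $D^s_f(G;W)$) is the maximum diameter of a graph obtained from $G$ by removing at most $\kappa(G;W)-1$ pairwise vertex-disjoint $W$-structures (resp. at most $\kappa^s(G;W)-1$ pairwise vertex-disjoint $W$-substructures). -}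

module Defs where

open import Data.Nat using (ℕ; zero; suc; _≤_; _∸_)
open import Data.Bool using (Bool)
open import Data.Fin using (Fin)
open import Data.Vec using (Vec; lookup)
open import Data.List using (List; []; _∷_; length; concatMap)
open import Data.List.Membership.Propositional using (_∈_; _∉_)
open import Data.List.Relation.Unary.Unique.Propositional using (Unique)
open import Data.Product using (Σ; ∃; _×_)
open import Relation.Binary.PropositionalEquality using (_≡_; _≢_)
open import Relation.Nullary using (¬_)

Vertex : ℕ → Set
Vertex n = Vec Bool n

Adj : {n : ℕ} → Vertex n → Vertex n → Set
Adj {n} u v = Σ (Fin n) λ i →
  (lookup u i ≢ lookup v i) × (∀ (j : Fin n) → j ≢ i → lookup u j ≡ lookup v j)

data Walk {n : ℕ} (R : List (Vertex n)) : Vertex n → Vertex n → ℕ → Set where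
  stop : ∀ {u} → u ∉ R → Walk R u u zero
  step : ∀ {u w v k} → u ∉ R → Adj u w → Walk R w v k → Walk R u v (suc k)

Disconnected : {n : ℕ} → List (Vertex n) → Set
Disconnected {n} R = Σ (Vertex n) λ u → Σ (Vertex n) λ v →
  (u ∉ R) × (v ∉ R) × (∀ k → ¬ Walk R u v k)

-- A subgraph of Q_n isomorphic to Q_1 = K_2 is an edge.
data Q1Str (n : ℕ) : Set where
  edge : (u v : Vertex n) → Adj u v → Q1Str n

-- Connected subgraphs of Q_1 = K_2 are K_1 and K_2, so a Q_1-substructure
-- is a single vertex or an edge.
data Q1Sub (n : ℕ) : Set where
  vtx  : (u : Vertex n) → Q1Sub n
  edge : (u v : Vertex n) → Adj u v → Q1Sub n

strVerts : {n : ℕ} → Q1Str n → List (Vertex n)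
strVerts (edge u v _) = u ∷ v ∷ []

subVerts : {n : ℕ} → Q1Sub n → List (Vertex n)
subVerts (vtx u) = u ∷ []
subVerts (edge u v _) = u ∷ v ∷ []

module _ {n : ℕ} {S : Set} (verts : S → List (Vertex n)) where

  Removed : List S → List (Vertex n)
  Removed F = concatMap verts F

  PairwiseDisjoint : List S → Set
  PairwiseDisjoint F = Unique (Removed F)

  IsKappa : ℕ → Set
  IsKappa t =
    (Σ (List S) λ F → PairwiseDisjoint F × length F ≡ t × Disconnected (Removed F))
    × (∀ (F : List S) → PairwiseDisjoint F → Disconnected (Removed F) → t ≤ length F)

  -- D_f ≥ d : some removal of at most κ-1 pairwise disjoint structures
  -- leaves a graph of diameter ≥ d, i.e. containing two vertices at
  -- distance ≥ d (every walk between them has length ≥ d).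
  DfAtLeast : ℕ → Set
  DfAtLeast d = ∀ (t : ℕ) → IsKappa t →
    Σ (List S) λ F → PairwiseDisjoint F × length F ≤ t ∸ 1 ×
      (Σ (Vertex n) λ u → Σ (Vertex n) λ v →
        (u ∉ Removed F) × (v ∉ Removed F) ×
        (∀ k → Walk (Removed F) u v k → d ≤ k))

-- At most n − 2 Q₁-substructures never disconnect Q_n (n ≥ 2), by induction on n: split Q_n
-- along the first coordinate into two copies of Q_{n−1}. If each copy meets at most n − 3 of
-- the structures, both copies stay connected, and as at most 2n − 4 < 2^{n−1} vertices are
-- removed, some column {0x, 1x} survives and joins them. Otherwise all structures meet one
-- copy b; their vertices in the other copy are then partners of their vertices in b, so every
-- surviving vertex of b has a surviving partner in the other copy. That copy is connected by
-- induction unless all structures meet it too, i.e. are edges across; then some copy loses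
-- at most n − 2 vertices and stays connected because Q_{n−1} is (n − 1)-connected. Hence
-- κ ≥ n − 1 for both kinds of structure.
--
-- Now remove the n − 2 edges {00e_j, 01e_j}, e_j running over the unit vectors of length n − 2.
-- The only surviving neighbours of u = 00…0 are 10…0, at Hamming distance n from v = 011…1,
-- and 010…0, whose only surviving neighbours u and 110…0 are at distance n − 1 from v. So every
-- surviving walk from u to v has length at least n + 1.
module Submission where

open import Data.Bool using (Bool; true; false; not; _xor_; if_then_else_)
open import Data.Bool.Properties using (not-¬; ¬-not) renaming (_≟_ to _≟ᵇ_)
open import Data.Empty using (⊥; ⊥-elim)
open import Data.Fin using (Fin; zero; suc)
open import Data.Fin.Properties using (suc-injective) renaming (_≟_ to _≟ᶠ_)
open import Data.List using (List; []; _∷_; _++_; length; map; concat; filter; tabulate; cartesianProductWith)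
open import Data.List.Properties
  using (length-map; length-filter; length-++; length-tabulate; map-++; filter-++; filter-none; filter-notAll)
open import Data.List.Membership.Propositional using (_∈_; _∉_; find)
open import Data.List.Membership.Propositional.Properties
  using (∈-map⁺; ∈-map⁻; ∈-filter⁺; ∈-filter⁻; ∈-++⁺ˡ; ∈-++⁺ʳ; ∈-++⁻; ∈-tabulate⁺; ∈-tabulate⁻;
         ∈-cartesianProductWith⁺; ∈-cartesianProductWith⁻)
open import Data.List.Relation.Unary.All as All using (All; []; _∷_; all?)
open import Data.List.Relation.Unary.All.Properties using (¬All⇒Any¬; ¬Any⇒All¬)
import Data.List.Relation.Unary.All.Properties as Allₚ
open import Data.List.Relation.Unary.Any using (Any; here; there; any?)
open import Data.List.Relation.Unary.AllPairs using ([]; _∷_)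
open import Data.List.Relation.Unary.Unique.Propositional using (Unique)
open import Data.List.Relation.Unary.Unique.Propositional.Properties using (tabulate⁺; cartesianProductWith⁺)
open import Data.Nat using (ℕ; zero; suc; _+_; _*_; _^_; _≤_; _<_; z≤n; s≤s; _≤?_)
open import Data.Nat.Properties
  using (≤-refl; ≤-reflexive; ≤-trans; ≤-<-trans; <⇒≤; ≰⇒>; ≮⇒≥; ≤-pred; _<?_; n≤1+n; m≤n⇒m≤1+n;
         +-comm; +-suc; +-identityʳ; +-mono-≤; +-monoˡ-≤; +-cancelˡ-≤; +-cancelˡ-<;
         *-suc; *-monoʳ-≤; *-monoʳ-<; m^n>0; ∸-monoˡ-≤; module ≤-Reasoning)
open import Data.Product using (Σ; ∃; ∃₂; _×_; _,_; proj₁; proj₂)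
open import Data.Sum using (_⊎_; inj₁; inj₂; [_,_]′)
import Data.Sum as Sum
open import Data.Vec using (Vec; []; _∷_; head; tail; lookup; replicate; _[_]%=_)
open import Data.Vec.Properties using (∷-injectiveˡ; ∷-injectiveʳ; lookup∘updateAt; lookup∘updateAt′)
open import Data.Vec.Relation.Binary.Pointwise.Extensional using (ext; Pointwise-≡⇒≡)
open import Function using (_∘_)
open import Relation.Binary.PropositionalEquality
  using (_≡_; _≢_; refl; sym; trans; cong; cong₂; subst; module ≡-Reasoning)
open import Relation.Nullary using (¬_; Dec; yes; no; contradiction)

open import Defs

private
  variable
    n m k : ℕ
    b c : Bool
    x y u v w : Vertex n
    R : List (Vertex n)

adj-sym : Adj u v → Adj v u
adj-sym (i , u≢v , same) = i , u≢v ∘ sym , λ j j≢i → sym (same j j≢i)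

adj-∷ : ∀ b → Adj x y → Adj (b ∷ x) (b ∷ y)
adj-∷ b (i , x≢y , same) = suc i , x≢y , λ { zero _ → refl ; (suc j) j≢i → same j (j≢i ∘ cong suc) }

adj-tail : Adj (b ∷ x) (b ∷ y) → Adj x y
adj-tail (zero , b≢b , _) = contradiction refl b≢b
adj-tail (suc i , x≢y , same) = i , x≢y , λ j j≢i → same (suc j) (j≢i ∘ suc-injective)

adj-across : ∀ b (x : Vertex n) → Adj (b ∷ x) (not b ∷ x)
adj-across b x = zero , not-¬ refl , λ { zero 0≢0 → contradiction refl 0≢0 ; (suc j) _ → refl }

adj⇒flip : (a : Adj u v) → v ≡ u [ proj₁ a ]%= not
adj⇒flip {u = u} {v} (i , u≢v , same) = Pointwise-≡⇒≡ (ext coordinate)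
  where
  coordinate : ∀ j → lookup v j ≡ lookup (u [ i ]%= not) j
  coordinate j with j ≟ᶠ i
  ... | yes refl = trans (¬-not (u≢v ∘ sym)) (sym (lookup∘updateAt i u))
  ... | no j≢i = trans (sym (same j j≢i)) (sym (lookup∘updateAt′ j i j≢i u))

adj-across⇒≡ : Adj (b ∷ x) (not b ∷ y) → x ≡ y
adj-across⇒≡ {b = b} {x = x} {y = y} a with adj⇒flip {u = b ∷ x} {v = not b ∷ y} a
adj-across⇒≡ (zero , _) | eq = sym (∷-injectiveʳ eq)
adj-across⇒≡ (suc _ , _) | eq = contradiction (sym (∷-injectiveˡ eq)) (not-¬ refl)

_++ʷ_ : ∀ {l} → Walk R u w k → Walk R w v l → Walk R u v (k + l)
stop _ ++ʷ q = q
step u∉ a p ++ʷ q = step u∉ a (p ++ʷ q)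

_⨾_ : ∃ (Walk R u w) → ∃ (Walk R w v) → ∃ (Walk R u v)
(k , p) ⨾ (l , q) = k + l , p ++ʷ q

infixr 5 _⨾_

source∉ : Walk R u v k → u ∉ R
source∉ (stop u∉) = u∉
source∉ (step u∉ _ _) = u∉

Connected : List (Vertex n) → Set
Connected R = ∀ {u v} → u ∉ R → v ∉ R → ∃ (Walk R u v)

disconnected⇒¬connected : Disconnected R → Connected R → ⊥
disconnected⇒¬connected (_ , _ , u∉ , v∉ , no-walk) connected =
  let k , walk = connected u∉ v∉ in no-walk k walk

InHalf : Bool → Vertex (suc n) → Set
InHalf b u = head u ≡ b

inHalf? : ∀ b (u : Vertex (suc n)) → Dec (InHalf b u)
inHalf? b u = head u ≟ᵇ b

half : Bool → List (Vertex (suc n)) → List (Vertex n)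
half b = map tail ∘ filter (inHalf? b)

∈-half⁺ : (b ∷ x) ∈ R → x ∈ half b R
∈-half⁺ {b = b} x∈ = ∈-map⁺ tail (∈-filter⁺ (inHalf? b) x∈ refl)

∈-half⁻ : x ∈ half b R → (b ∷ x) ∈ R
∈-half⁻ {b = b} x∈ with ∈-map⁻ tail x∈
... | (_ ∷ _) , u∈ , refl with ∈-filter⁻ (inHalf? b) u∈
...   | u∈R , refl = u∈R

half-++ : ∀ (xs ys : List (Vertex (suc n))) → half b (xs ++ ys) ≡ half b xs ++ half b ys
half-++ {b = b} xs ys =
  trans (cong (map tail) (filter-++ (inHalf? b) xs ys)) (map-++ tail (filter (inHalf? b) xs) (filter (inHalf? b) ys))

length-halves : ∀ (R : List (Vertex (suc n))) → length (half false R) + length (half true R) ≡ length R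
length-halves [] = refl
length-halves ((false ∷ _) ∷ R) = cong suc (length-halves R)
length-halves ((true ∷ _) ∷ R) = trans (+-suc _ _) (cong suc (length-halves R))

walk-∷ : ∀ b → Walk (half b R) x y k → Walk R (b ∷ x) (b ∷ y) k
walk-∷ b (stop x∉) = stop (x∉ ∘ ∈-half⁺)
walk-∷ b (step x∉ a p) = step (x∉ ∘ ∈-half⁺) (adj-∷ b a) (walk-∷ b p)

within-half : Connected (half b R) → (b ∷ x) ∉ R → (b ∷ y) ∉ R → ∃ (Walk R (b ∷ x) (b ∷ y))
within-half {b = b} connected x∉ y∉ =
  let k , p = connected (x∉ ∘ ∈-half⁻) (y∉ ∘ ∈-half⁻) in k , walk-∷ b p

within-column : (b ∷ x) ∉ R → (c ∷ x) ∉ R → ∃ (Walk R (b ∷ x) (c ∷ x))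
within-column {b = false} {c = false} x∉ _ = 0 , stop x∉
within-column {b = true} {c = true} x∉ _ = 0 , stop x∉
within-column {b = false} {x = x} {c = true} x∉ x′∉ = 1 , step x∉ (adj-across false x) (stop x′∉)
within-column {b = true} {x = x} {c = false} x∉ x′∉ = 1 , step x∉ (adj-across true x) (stop x′∉)

connected-via-column : (∀ b → Connected (half b R)) → (∀ b → (b ∷ x) ∉ R) → Connected R
connected-via-column halves free {b ∷ _} {c ∷ _} u∉ v∉ =
  within-half (halves b) u∉ (free b) ⨾ within-column (free b) (free c) ⨾ within-half (halves c) (free c) v∉

partner∉ : ∀ b c → (∀ {x} → (b ∷ x) ∈ R → (not b ∷ x) ∈ R) → (c ∷ x) ∉ R → (b ∷ x) ∉ R
partner∉ false false _ x∉ = x∉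
partner∉ true true _ x∉ = x∉
partner∉ false true paired x∉ = x∉ ∘ paired
partner∉ true false paired x∉ = x∉ ∘ paired

connected-via-half : ∀ b → Connected (half b R) → (∀ {x} → (b ∷ x) ∈ R → (not b ∷ x) ∈ R) → Connected R
connected-via-half b connected paired {c ∷ _} {d ∷ _} u∉ v∉ =
  within-column u∉ u′∉ ⨾ within-half connected u′∉ v′∉ ⨾ within-column v′∉ v∉
  where
  u′∉ = partner∉ b c paired u∉
  v′∉ = partner∉ b d paired v∉

m+n<2*o⇒m<o⊎n<o : ∀ m n o → m + n < 2 * o → m < o ⊎ n < o
m+n<2*o⇒m<o⊎n<o m n o m+n<2o with m <? o
... | yes m<o = inj₁ m<o
... | no m≮o = inj₂ (+-cancelˡ-< o n o (begin-strict
  o + n   ≤⟨ +-monoˡ-≤ n (≮⇒≥ m≮o) ⟩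
  m + n   <⟨ m+n<2o ⟩
  2 * o   ≡⟨ cong (o +_) (+-identityʳ o) ⟩
  o + o   ∎))
  where open ≤-Reasoning

m+n≤2*o⇒m≤o⊎n≤o : ∀ m n o → m + n ≤ 2 * o → m ≤ o ⊎ n ≤ o
m+n≤2*o⇒m≤o⊎n≤o m n o m+n≤2o with m ≤? o
... | yes m≤o = inj₁ m≤o
... | no m≰o = inj₂ (+-cancelˡ-≤ o n o (begin
  o + n   ≤⟨ +-monoˡ-≤ n (<⇒≤ (≰⇒> m≰o)) ⟩
  m + n   ≤⟨ m+n≤2o ⟩
  2 * o   ≡⟨ cong (o +_) (+-identityʳ o) ⟩
  o + o   ∎))
  where open ≤-Reasoning

n<2^n : ∀ n → n < 2 ^ n
n<2^n zero = s≤s z≤n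
n<2^n (suc n) = begin-strict
  suc n           <⟨ +-mono-≤ (m^n>0 2 n) (n<2^n n) ⟩
  2 ^ n + 2 ^ n   ≡⟨ cong (2 ^ n +_) (sym (+-identityʳ (2 ^ n))) ⟩
  2 ^ suc n       ∎
  where open ≤-Reasoning

∃∉ : ∀ n (L : List (Vertex n)) → length L < 2 ^ n → ∃ (_∉ L)
∃∉ zero [] _ = [] , λ ()
∃∉ zero (_ ∷ _) (s≤s ())
∃∉ (suc n) L |L|<2^[1+n] with m+n<2*o⇒m<o⊎n<o _ _ (2 ^ n) (subst (_< 2 ^ suc n) (sym (length-halves L)) |L|<2^[1+n])
... | inj₁ few = let x , x∉ = ∃∉ n (half false L) few in false ∷ x , x∉ ∘ ∈-half⁺
... | inj₂ few = let x , x∉ = ∃∉ n (half true L) few in true ∷ x , x∉ ∘ ∈-half⁺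

free-column : (R : List (Vertex (suc n))) → length R < 2 ^ n → ∃ λ x → ∀ b → (b ∷ x) ∉ R
free-column {n} R |R|<2^n =
  let x , x∉ = ∃∉ n (map tail R) (subst (_< 2 ^ n) (sym (length-map tail R)) |R|<2^n)
  in x , λ _ → x∉ ∘ ∈-map⁺ tail

Q₀-connected : (R : List (Vertex 0)) → Connected R
Q₀-connected R {[]} {[]} u∉ _ = 0 , stop u∉

length≤0⇒∉ : ∀ {A : Set} {xs : List A} {a : A} → length xs ≤ 0 → a ∉ xs
length≤0⇒∉ {xs = []} _ ()

o<m⇒m+n≤1+o⇒n≤0 : ∀ {m n o} → o < m → m + n ≤ suc o → n ≤ 0
o<m⇒m+n≤1+o⇒n≤0 {m} {n} {o} o<m m+n≤1+o = +-cancelˡ-≤ (suc o) n 0 (begin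
  suc o + n   ≤⟨ +-monoˡ-≤ n o<m ⟩
  m + n       ≤⟨ m+n≤1+o ⟩
  suc o       ≡⟨ sym (+-identityʳ (suc o)) ⟩
  suc o + 0   ∎)
  where open ≤-Reasoning

connected-minus-vertices : ∀ n (R : List (Vertex (suc n))) → length R ≤ n → Connected R
connected-minus-vertices zero [] z≤n = connected-via-half false (Q₀-connected []) (λ ())
connected-minus-vertices (suc n) R |R|≤1+n with length (half false R) ≤? n | length (half true R) ≤? n
... | yes few₀ | yes few₁ =
  connected-via-column (λ { false → connected-minus-vertices n _ few₀ ; true → connected-minus-vertices n _ few₁ })
    (proj₂ (free-column R (≤-<-trans |R|≤1+n (n<2^n (suc n)))))
... | no many₀ | _ =
  let empty₁ = o<m⇒m+n≤1+o⇒n≤0 (≰⇒> many₀) (subst (_≤ suc n) (sym (length-halves R)) |R|≤1+n)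
  in connected-via-half true (connected-minus-vertices n _ (≤-trans empty₁ z≤n)) (⊥-elim ∘ length≤0⇒∉ empty₁ ∘ ∈-half⁺)
... | _ | no many₁ =
  let empty₀ = o<m⇒m+n≤1+o⇒n≤0 (≰⇒> many₁)
                 (subst (_≤ suc n) (sym (trans (+-comm (length (half true R)) _) (length-halves R))) |R|≤1+n)
  in connected-via-half false (connected-minus-vertices n _ (≤-trans empty₀ z≤n)) (⊥-elim ∘ length≤0⇒∉ empty₀ ∘ ∈-half⁺)

-- Q₁-substructures are handled through their vertex lists, since the trace of an edge on
-- one half of the cube may be a single vertex: a small clique again, but no longer an edge.
record SmallClique (C : List (Vertex n)) : Set where
  field
    size≤2 : length C ≤ 2
    linked : ∀ {x y} → x ∈ C → y ∈ C → x ≡ y ⊎ Adj x y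

open SmallClique

vertex-clique : SmallClique (u ∷ [])
vertex-clique = record { size≤2 = s≤s z≤n ; linked = λ { (here refl) (here refl) → inj₁ refl } }

edge-clique : Adj u v → SmallClique (u ∷ v ∷ [])
edge-clique {u = u} {v = v} a = record { size≤2 = ≤-refl ; linked = linked′ }
  where
  linked′ : ∀ {x y} → x ∈ _ → y ∈ _ → x ≡ y ⊎ Adj x y
  linked′ (here refl) (here refl) = inj₁ refl
  linked′ (here refl) (there (here refl)) = inj₂ a
  linked′ (there (here refl)) (here refl) = inj₂ (adj-sym {u = u} {v = v} a)
  linked′ (there (here refl)) (there (here refl)) = inj₁ refl

str-clique : (s : Q1Str n) → SmallClique (strVerts s)
str-clique (edge _ _ a) = edge-clique a

sub-clique : (s : Q1Sub n) → SmallClique (subVerts s)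
sub-clique (vtx _) = vertex-clique
sub-clique (edge _ _ a) = edge-clique a

half-clique : ∀ b {C : List (Vertex (suc n))} → SmallClique C → SmallClique (half b C)
half-clique b {C} clique = record
  { size≤2 = begin
      length (half b C)                ≡⟨ length-map tail (filter (inHalf? b) C) ⟩
      length (filter (inHalf? b) C)    ≤⟨ length-filter (inHalf? b) C ⟩
      length C                         ≤⟨ size≤2 clique ⟩
      2                                ∎
  ; linked = λ x∈ y∈ → Sum.map ∷-injectiveʳ adj-tail (linked clique (∈-half⁻ x∈) (∈-half⁻ y∈))
  }
  where open ≤-Reasoning

Meets : Bool → List (Vertex (suc n)) → Set
Meets b = Any (InHalf b)

meets? : ∀ b (C : List (Vertex (suc n))) → Dec (Meets b C)
meets? b = any? (inHalf? b)

¬meets⇒half≡[] : ∀ {C : List (Vertex (suc n))} → ¬ Meets b C → half b C ≡ []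
¬meets⇒half≡[] {b = b} {C} ¬meets = cong (map tail) (filter-none (inHalf? b) (¬Any⇒All¬ C ¬meets))

meets⇒paired : ∀ {C : List (Vertex (suc n))} → SmallClique C → Meets b C → (not b ∷ x) ∈ C → (b ∷ x) ∈ C
meets⇒paired clique meets x∈ with find meets
... | (_ ∷ y) , y∈ , refl with linked clique y∈ x∈
...   | inj₁ eq = contradiction (∷-injectiveˡ eq) (not-¬ refl)
...   | inj₂ a = subst (λ z → (_ ∷ z) ∈ _) (adj-across⇒≡ a) y∈

all-meet⇒paired : ∀ {F : List (List (Vertex (suc n)))} → All SmallClique F → All (Meets b) F →
                  (not b ∷ x) ∈ concat F → (b ∷ x) ∈ concat F
all-meet⇒paired {F = C ∷ _} (clique ∷ cliques) (meets ∷ meet) x∈ with ∈-++⁻ C x∈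
... | inj₁ x∈C = ∈-++⁺ˡ (meets⇒paired clique meets x∈C)
... | inj₂ x∈F = ∈-++⁺ʳ C (all-meet⇒paired cliques meet x∈F)

restrict : Bool → List (List (Vertex (suc n))) → List (List (Vertex n))
restrict b F = map (half b) (filter (meets? b) F)

concat-restrict : ∀ b (F : List (List (Vertex (suc n)))) → concat (restrict b F) ≡ half b (concat F)
concat-restrict b [] = refl
concat-restrict b (C ∷ F) with meets? b C
... | yes _ = trans (cong (half b C ++_) (concat-restrict b F)) (sym (half-++ C (concat F)))
... | no ¬meets = begin
  concat (restrict b F)              ≡⟨ concat-restrict b F ⟩
  half b (concat F)                  ≡⟨ cong (_++ half b (concat F)) (sym (¬meets⇒half≡[] ¬meets)) ⟩
  half b C ++ half b (concat F)      ≡⟨ sym (half-++ C (concat F)) ⟩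
  half b (C ++ concat F)             ∎
  where open ≡-Reasoning

restrict-cliques : ∀ b {F : List (List (Vertex (suc n)))} → All SmallClique F → All SmallClique (restrict b F)
restrict-cliques b cliques = Allₚ.map⁺ (All.map (half-clique b) (Allₚ.filter⁺ (meets? b) cliques))

length-concat-cliques : ∀ {F : List (List (Vertex n))} → All SmallClique F → length (concat F) ≤ 2 * length F
length-concat-cliques [] = z≤n
length-concat-cliques {F = C ∷ F} (clique ∷ cliques) = begin
  length (C ++ concat F)           ≡⟨ length-++ C ⟩
  length C + length (concat F)     ≤⟨ +-mono-≤ (size≤2 clique) (length-concat-cliques cliques) ⟩
  2 + 2 * length F                 ≡⟨ sym (*-suc 2 (length F)) ⟩
  2 * suc (length F)               ∎
  where open ≤-Reasoning

-- A clique missing half b leaves no trace on it, so if there is one, fewer cliques cover that half.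
half-connected⊎all-meet : ∀ b {F : List (List (Vertex (suc n)))} →
  (∀ G → All SmallClique G → length G ≤ m → Connected (concat G)) →
  All SmallClique F → length F ≤ suc m → Connected (half b (concat F)) ⊎ All (Meets b) F
half-connected⊎all-meet b {F} connected-if-few cliques |F|≤1+m with all? (meets? b) F
... | yes meet = inj₂ meet
... | no ¬meet = inj₁ (subst Connected (concat-restrict b F)
        (connected-if-few (restrict b F) (restrict-cliques b cliques) (≤-pred (≤-trans shrinks |F|≤1+m))))
  where
  shrinks : length (restrict b F) < length F
  shrinks = subst (_< length F) (sym (length-map (half b) (filter (meets? b) F)))
                  (filter-notAll (meets? b) F (¬All⇒Any¬ (meets? b) F ¬meet))

connected-minus-cliques : ∀ m (F : List (List (Vertex (2 + m)))) → All SmallClique F → length F ≤ m →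
                          Connected (concat F)
connected-minus-cliques zero [] [] z≤n = connected-minus-vertices 1 [] z≤n
connected-minus-cliques (suc m) F cliques |F|≤1+m =
  combine (half-connected⊎all-meet false (connected-minus-cliques m) cliques |F|≤1+m)
          (half-connected⊎all-meet true (connected-minus-cliques m) cliques |F|≤1+m)
  where
  |removed|≤2[1+m] : length (concat F) ≤ 2 * suc m
  |removed|≤2[1+m] = ≤-trans (length-concat-cliques cliques) (*-monoʳ-≤ 2 |F|≤1+m)

  combine : Connected (half false (concat F)) ⊎ All (Meets false) F →
            Connected (half true (concat F)) ⊎ All (Meets true) F → Connected (concat F)
  combine (inj₁ connected₀) (inj₁ connected₁) =
    connected-via-column (λ { false → connected₀ ; true → connected₁ })
      (proj₂ (free-column (concat F) (≤-<-trans |removed|≤2[1+m] (*-monoʳ-< 2 (n<2^n (suc m))))))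
  combine (inj₂ meet₀) (inj₁ connected₁) = connected-via-half true connected₁ (all-meet⇒paired cliques meet₀)
  combine (inj₁ connected₀) (inj₂ meet₁) = connected-via-half false connected₀ (all-meet⇒paired cliques meet₁)
  combine (inj₂ meet₀) (inj₂ meet₁) =
    [ (λ few₀ → connected-via-half false (connected-minus-vertices (suc m) _ few₀) (all-meet⇒paired cliques meet₁))
    , (λ few₁ → connected-via-half true (connected-minus-vertices (suc m) _ few₁) (all-meet⇒paired cliques meet₀))
    ]′ (m+n≤2*o⇒m≤o⊎n≤o _ _ (suc m) (subst (_≤ 2 * suc m) (sym (length-halves (concat F))) |removed|≤2[1+m]))

hamming : Vec Bool n → Vec Bool n → ℕ
hamming [] [] = 0
hamming (a ∷ x) (b ∷ y) = if a xor b then suc (hamming x y) else hamming x y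

hamming-refl : ∀ (x : Vec Bool n) → hamming x x ≡ 0
hamming-refl [] = refl
hamming-refl (false ∷ x) = hamming-refl x
hamming-refl (true ∷ x) = hamming-refl x

hamming-replicate : ∀ m → hamming (replicate m false) (replicate m true) ≡ m
hamming-replicate zero = refl
hamming-replicate (suc m) = cong suc (hamming-replicate m)

hamming-flip : ∀ (x : Vec Bool n) i z → hamming x z ≤ suc (hamming (x [ i ]%= not) z)
hamming-flip (false ∷ x) zero (false ∷ z) = m≤n⇒m≤1+n (n≤1+n _)
hamming-flip (false ∷ x) zero (true ∷ z) = ≤-refl
hamming-flip (true ∷ x) zero (false ∷ z) = ≤-refl
hamming-flip (true ∷ x) zero (true ∷ z) = m≤n⇒m≤1+n (n≤1+n _)
hamming-flip (a ∷ x) (suc i) (c ∷ z) with a xor c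
... | true = s≤s (hamming-flip x i z)
... | false = hamming-flip x i z

first-step : Walk R u v (suc k) → Σ (Fin n) λ i → Walk R (u [ i ]%= not) v k
first-step {u = u} (step {w = w} _ a@(i , _) p) with adj⇒flip {u = u} {v = w} a
... | refl = i , p

hamming≤length : Walk R x y k → hamming x y ≤ k
hamming≤length {y = y} {k = zero} (stop _) = ≤-reflexive (hamming-refl y)
hamming≤length {x = x} {y = y} {k = suc k} p with first-step p
... | i , q = ≤-trans (hamming-flip x i y) (s≤s (hamming≤length q))

unit : Fin m → Vec Bool m
unit j = replicate _ false [ j ]%= not

unit-injective : ∀ {i j : Fin m} → unit i ≡ unit j → i ≡ j
unit-injective {i = zero} {zero} _ = refl
unit-injective {i = suc i} {suc j} eq = cong suc (unit-injective (∷-injectiveʳ eq))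

replicate-false≢unit : ∀ (j : Fin m) → replicate m false ≢ unit j
replicate-false≢unit {suc m} (suc j) eq = replicate-false≢unit j (∷-injectiveʳ eq)

replicate-true≢unit : ∀ (j : Fin (2 + m)) → replicate (2 + m) true ≢ unit j
replicate-true≢unit zero ()
replicate-true≢unit (suc j) ()

barrierVertex : Vec Bool m → Bool → Vertex (2 + m)
barrierVertex t b = false ∷ b ∷ t

rung : ∀ (t : Vec Bool m) → Adj (barrierVertex t false) (barrierVertex t true)
rung t = adj-∷ false (adj-across false t)

barrier : ∀ m → List (Vertex (2 + m))
barrier m = cartesianProductWith barrierVertex (tabulate unit) (false ∷ true ∷ [])

barrier-unique : Unique (barrier m)
barrier-unique = cartesianProductWith⁺ barrierVertex (λ { refl → refl , refl })
  (tabulate⁺ unit-injective) (((λ ()) ∷ []) ∷ [] ∷ [])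

∈-barrier⁺ : ∀ (j : Fin m) b → barrierVertex (unit j) b ∈ barrier m
∈-barrier⁺ j false = ∈-cartesianProductWith⁺ barrierVertex (∈-tabulate⁺ j) (here refl)
∈-barrier⁺ j true = ∈-cartesianProductWith⁺ barrierVertex (∈-tabulate⁺ j) (there (here refl))

∈-barrier⁻ : u ∈ barrier m → ∃₂ λ j b → u ≡ barrierVertex (unit j) b
∈-barrier⁻ {m = m} u∈ with ∈-cartesianProductWith⁻ barrierVertex (tabulate unit) (false ∷ true ∷ []) u∈
... | t , b , t∈ , _ , refl with ∈-tabulate⁻ t∈
...   | j , refl = j , b , refl

origin target : Vertex (2 + m)
origin = barrierVertex (replicate _ false) false
target = barrierVertex (replicate _ true) true

origin∉barrier : origin ∉ barrier m
origin∉barrier o∈ with ∈-barrier⁻ o∈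
... | j , _ , eq = replicate-false≢unit j (∷-injectiveʳ (∷-injectiveʳ eq))

target∉barrier : target ∉ barrier (2 + m)
target∉barrier t∈ with ∈-barrier⁻ t∈
... | j , _ , eq = replicate-true≢unit j (∷-injectiveʳ (∷-injectiveʳ eq))

walk-to-target-length : ∀ c {w : Vertex (3 + m)} →
  hamming w target ≡ c + hamming (replicate m false) (replicate m true) → Walk R w target k → c + m ≤ k
walk-to-target-length {m} {k = k} c eq p =
  subst (λ h → c + h ≤ k) (hamming-replicate m) (subst (_≤ k) eq (hamming≤length p))

detour-via-upper : Walk (barrier (suc m)) (barrierVertex (replicate _ false) true) target k → 3 + m ≤ k
detour-via-upper {k = suc k} p with first-step p
... | zero , q = s≤s (walk-to-target-length 2 refl q)
... | suc zero , q = s≤s (walk-to-target-length 2 refl q)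
... | suc (suc j) , q = ⊥-elim (source∉ q (∈-barrier⁺ j true))

detour : Walk (barrier (suc m)) origin target k → 4 + m ≤ k
detour {k = suc k} p with first-step p
... | zero , q = s≤s (walk-to-target-length 3 refl q)
... | suc zero , q = s≤s (detour-via-upper q)
... | suc (suc j) , q = ⊥-elim (source∉ q (∈-barrier⁺ j false))

FarPair : List (Vertex n) → ℕ → Set
FarPair {n} R d = Σ (Vertex n) λ u → Σ (Vertex n) λ v → (u ∉ R) × (v ∉ R) × (∀ k → Walk R u v k → d ≤ k)

barrier-far : FarPair (barrier (2 + m)) (5 + m)
barrier-far = origin , target , origin∉barrier , target∉barrier , λ _ → detour

module _ {S : Set} (verts : S → List (Vertex (2 + m))) (cliques : ∀ s → SmallClique (verts s)) where

  disconnecting⇒length> : ∀ F → Disconnected (Removed verts F) → m < length F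
  disconnecting⇒length> F disconnected = ≰⇒> λ |F|≤m →
    disconnected⇒¬connected disconnected
      (connected-minus-cliques m (map verts F) (Allₚ.map⁺ (All.universal cliques F))
        (subst (_≤ m) (sym (length-map verts F)) |F|≤m))

  DfAtLeast-intro : ∀ {d} F → PairwiseDisjoint verts F → length F ≤ m → FarPair (Removed verts F) d →
                    DfAtLeast verts d
  DfAtLeast-intro F disjoint |F|≤m far _ ((F₀ , _ , refl , disconnected) , _) =
    F , disjoint , ≤-trans |F|≤m (∸-monoˡ-≤ 1 (disconnecting⇒length> F₀ disconnected)) , far

barrier-DfAtLeast : ∀ {S : Set} (verts : S → List (Vertex (4 + m))) → (∀ s → SmallClique (verts s)) →
  (rung-of : Vec Bool (2 + m) → S) → (∀ t → verts (rung-of t) ≡ barrierVertex t false ∷ barrierVertex t true ∷ []) →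
  DfAtLeast verts (5 + m)
barrier-DfAtLeast {m} verts cliques rung-of rung-verts =
  DfAtLeast-intro verts cliques rungs
    (subst Unique (sym removed≡barrier) barrier-unique)
    (≤-reflexive (trans (length-map rung-of (tabulate unit)) (length-tabulate unit)))
    (subst (λ R → FarPair R _) (sym removed≡barrier) barrier-far)
  where
  rungs = map rung-of (tabulate unit)

  removed-map : ∀ T → Removed verts (map rung-of T) ≡ cartesianProductWith barrierVertex T (false ∷ true ∷ [])
  removed-map [] = refl
  removed-map (t ∷ T) = cong₂ _++_ (rung-verts t) (removed-map T)

  removed≡barrier : Removed verts rungs ≡ barrier (2 + m)
  removed≡barrier = removed-map (tabulate unit)

lemma3p3 : (n : ℕ) → 4 ≤ n →
    DfAtLeast (strVerts {n}) (suc n) × DfAtLeast (subVerts {n}) (suc n)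
lemma3p3 (suc (suc (suc (suc m)))) (s≤s (s≤s (s≤s (s≤s _)))) =
  barrier-DfAtLeast strVerts str-clique (λ t → edge _ _ (rung t)) (λ _ → refl) ,
  barrier-DfAtLeast subVerts sub-clique (λ t → edge _ _ (rung t)) (λ _ → refl)
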